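{- Let $n$ be a natural number and $\mathcal{F}_c,\mathcal{N}_c$ collections of finite families. If every irreducible family $F$ with $\bigcup F\subseteq\{0,\ldots,n-1\}$ is covered by $\mathcal{F}_c$ and $\mathcal{N}_c$, then every family $F$ with $\bigcup F\subseteq\{0,\ldots,n-1\}$ is covered by $\mathcal{F}_c$ and $\mathcal{N}_c$.
   Context: All sets and families are finite. The closure $\mathrm{cl}(F)$ of a family $F$ is the set of unions $\bigcup G$ over nonempty $G\subseteq F$. A family $F$ is irreducible if no $A\in F$ equals $\bigcup G$ for some nonempty $G\subseteq F\setminus\{A\}$. Families $F,F'$ are isomorphic if there is a bijection $f:\bigcup F\to\bigcup F'$ with $\{f[B]:B\in F\}=F'$. A family $F$ is FC-covered by a family $F_c$ if some family isomorphic to $F_c$ is contained in $\mathrm{cl}(F)$, and FC-covered by a collection $\mathcal{F}_c$ if FC-covered by some member of it. $F$ is nonFC-covered by a family $N_c$ if there is $N_c'$ isomorphic to $N_c$ with $\mathrm{cl}(F)\subseteq\mathrm{cl}(N_c')\cup\{\emptyset\}$, and nonFC-covered by a collection $\mathcal{N}_c$ if nonFC-covered by some member of it. $F$ is covered by $\mathcal{F}_c$ and $\mathcal{N}_c$ if it is FC-covered by $\mathcal{F}_c$ or nonFC-covered by $\mathcal{N}_c$. -}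

module Defs where

open import Data.Nat using (ℕ; _<_)
open import Data.List using (List; []; _∷_; map; concat)
open import Data.List.Membership.Propositional using (_∈_)
open import Data.List.Relation.Unary.Any using (Any)
open import Data.Product using (Σ; _×_; ∃)
open import Data.Sum using (_⊎_)
open import Relation.Nullary using (¬_)
open import Relation.Binary.PropositionalEquality using (_≡_)
open import Function.Bundles using (_⇔_)

-- A finite set of naturals, represented by a list (order/duplicates irrelevant).
FSet : Set
FSet = List ℕ

Family : Set
Family = List FSet

Collection : Set₁
Collection = Family → Set

_≐_ : FSet → FSet → Set
A ≐ B = ∀ x → (x ∈ A) ⇔ (x ∈ B)

_∈F_ : FSet → Family → Set
B ∈F F = Any (λ A → A ≐ B) F

⋃ : Family → FSet
⋃ F = concat F

NonEmpty : Family → Set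
NonEmpty G = ∃ λ B → B ∈F G

_∈cl_ : FSet → Family → Set
A ∈cl F = Σ Family λ G → NonEmpty G × (∀ B → B ∈F G → B ∈F F) × (A ≐ ⋃ G)

Irreducible : Family → Set
Irreducible F = ∀ A → A ∈F F →
  ¬ (Σ Family λ G → NonEmpty G
       × (∀ B → B ∈F G → (B ∈F F) × ¬ (B ≐ A))
       × (A ≐ ⋃ G))

img : (ℕ → ℕ) → FSet → FSet
img f B = map f B

Isomorphic : Family → Family → Set
Isomorphic F F' = Σ (ℕ → ℕ) λ f →
    (∀ x → x ∈ ⋃ F → f x ∈ ⋃ F')
  × (∀ x y → x ∈ ⋃ F → y ∈ ⋃ F → f x ≡ f y → x ≡ y)
  × (∀ y → y ∈ ⋃ F' → ∃ λ x → (x ∈ ⋃ F) × (f x ≡ y))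
  × (∀ B → B ∈F F → img f B ∈F F')
  × (∀ B' → B' ∈F F' → ∃ λ B → (B ∈F F) × (img f B ≐ B'))

FCCovered : Family → Family → Set
FCCovered F Fc = Σ Family λ F' → Isomorphic F' Fc × (∀ B → B ∈F F' → B ∈cl F)

FCCoveredBy : Family → Collection → Set
FCCoveredBy F 𝓕c = Σ Family λ Fc → 𝓕c Fc × FCCovered F Fc

NonFCCovered : Family → Family → Set
NonFCCovered F Nc = Σ Family λ Nc' → Isomorphic Nc' Nc
  × (∀ A → A ∈cl F → (A ∈cl Nc') ⊎ (A ≐ []))

NonFCCoveredBy : Family → Collection → Set
NonFCCoveredBy F 𝓝c = Σ Family λ Nc → 𝓝c Nc × NonFCCovered F Nc

Covered : Family → Collection → Collection → Set
Covered F 𝓕c 𝓝c = FCCoveredBy F 𝓕c ⊎ NonFCCoveredBy F 𝓝c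

BoundedBy : ℕ → Family → Set
BoundedBy n F = ∀ x → x ∈ ⋃ F → x < n

-- A member C of F that is the union of other members of F can be deleted without changing
-- cl(F), since C itself is recovered as a union in the smaller family. Deleting such members
-- one at a time terminates in an irreducible subfamily K with cl(K) = cl(F). Being covered
-- depends on F only through cl(F), and K still lives in {0, …, n-1}, so the hypothesis on K
-- transfers to F.
module Submission where

open import Defs
open import Data.Nat using (ℕ; _<_)
open import Data.Nat.Induction using (<-wellFounded)
open import Data.Nat.Properties using (_≟_; n<1+n)
open import Data.List using (List; []; _∷_; _++_; [_]; filter; length)
open import Data.List.Properties using (concat-++; ++-identityʳ)
open import Data.List.Membership.Propositional using (_∈_; find)
open import Data.List.Membership.Propositional.Properties
  using (∈-concat⁺′; ∈-concat⁻′; ∈-filter⁺; ∈-filter⁻; ∈-∃++)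
open import Data.List.Relation.Binary.Subset.Propositional using (_⊆_)
open import Data.List.Relation.Binary.Subset.Propositional.Properties
  using (⊆-refl; ⊆-trans; Any-resp-⊆; ++⁺; concat⁺)
open import Data.List.Relation.Binary.Subset.DecPropositional _≟_ using (_⊆?_)
open import Data.List.Relation.Binary.Permutation.Propositional using (_↭_; ↭-sym)
open import Data.List.Relation.Binary.Permutation.Propositional.Properties
  using (shift; ∈-resp-↭; ↭-length)
open import Data.List.Relation.Unary.Any as Any using (Any; here; there; any?)
import Data.List.Relation.Unary.Any.Properties as Any
open import Data.Product using (Σ; _×_; ∃; _,_; proj₁; proj₂)
open import Data.Sum using (inj₁; inj₂)
open import Function.Bundles using (_⇔_; mk⇔; Equivalence)
import Function.Properties.Equivalence as ⇔
open import Induction.WellFounded using (Acc; acc)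
open import Relation.Nullary using (¬_; Dec; yes; no; contradiction)
open import Relation.Nullary.Decidable using (map′; _×-dec_; ¬?)
open import Relation.Binary.PropositionalEquality using (refl; sym; subst)

private
  variable
    A B C : FSet
    F F′ G : Family

≐⇒⊆ : A ≐ B → A ⊆ B
≐⇒⊆ e = Equivalence.to (e _)

≐⇒⊇ : A ≐ B → B ⊆ A
≐⇒⊇ e = Equivalence.from (e _)

⊆-antisym : A ⊆ B → B ⊆ A → A ≐ B
⊆-antisym A⊆B B⊆A x = mk⇔ A⊆B B⊆A

≐-refl : A ≐ A
≐-refl x = ⇔.refl

≐-sym : A ≐ B → B ≐ A
≐-sym e x = ⇔.sym (e x)

≐-trans : A ≐ B → B ≐ C → A ≐ C
≐-trans e f x = ⇔.trans (e x) (f x)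

_≐?_ : (A B : FSet) → Dec (A ≐ B)
A ≐? B = map′ (λ (A⊆⊇B : A ⊆ B × B ⊆ A) → ⊆-antisym (proj₁ A⊆⊇B) (proj₂ A⊆⊇B))
              (λ e → ≐⇒⊆ e , ≐⇒⊇ e)
              (A ⊆? B ×-dec B ⊆? A)

∈⇒∈F : A ∈ F → A ≐ B → B ∈F F
∈⇒∈F A∈F e = Any.map (λ { refl → e }) A∈F

∈F-resp-≐ : A ≐ B → A ∈F F → B ∈F F
∈F-resp-≐ e = Any.map (λ e′ → ≐-trans e′ e)

∈F⇒⊆⋃ : B ∈F F → B ⊆ ⋃ F
∈F⇒⊆⋃ B∈F x∈B with D , D∈F , D≐B ← find B∈F = ∈-concat⁺′ (≐⇒⊇ D≐B x∈B) D∈F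

∈cl-resp-≐ : A ≐ B → A ∈cl F → B ∈cl F
∈cl-resp-≐ e (G , ne , G⊆F , A≐⋃G) = G , ne , G⊆F , ≐-trans (≐-sym e) A≐⋃G

∈F⇒∈cl : B ∈F F → B ∈cl F
∈F⇒∈cl {B} B∈F = subst (_∈cl _) (++-identityʳ B)
  ([ B ] , (B , here ≐-refl) , (λ { _ (here e) → ∈F-resp-≐ e B∈F }) , ≐-refl)

∪-∈cl : A ∈cl F → B ∈cl F → (A ++ B) ∈cl F
∪-∈cl {A = A} {F = F} {B = B} (G₁ , (D , D∈G₁) , G₁⊆F , A≐⋃G₁) (G₂ , _ , G₂⊆F , B≐⋃G₂) =
  G₁ ++ G₂ , (D , Any.++⁺ˡ D∈G₁) , members , subst ((A ++ B) ≐_) (concat-++ G₁ G₂) union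
  where
  members : ∀ D → D ∈F (G₁ ++ G₂) → D ∈F F
  members D D∈G with Any.++⁻ G₁ D∈G
  ... | inj₁ D∈G₁ = G₁⊆F D D∈G₁
  ... | inj₂ D∈G₂ = G₂⊆F D D∈G₂
  union : (A ++ B) ≐ (⋃ G₁ ++ ⋃ G₂)
  union = ⊆-antisym (++⁺ (≐⇒⊆ A≐⋃G₁) (≐⇒⊆ B≐⋃G₂)) (++⁺ (≐⇒⊇ A≐⋃G₁) (≐⇒⊇ B≐⋃G₂))

⋃-∈cl : ∀ G → NonEmpty G → (∀ B → B ∈ G → B ∈cl F) → ⋃ G ∈cl F
⋃-∈cl (B ∷ [])        _ cl = subst (_∈cl _) (sym (++-identityʳ B)) (cl B (here refl))
⋃-∈cl (B ∷ G@(D ∷ _)) _ cl =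
  ∪-∈cl (cl B (here refl)) (⋃-∈cl G (D , here ≐-refl) (λ B′ B′∈G → cl B′ (there B′∈G)))

_⊆cl_ : Family → Family → Set
F ⊆cl F′ = ∀ A → A ∈cl F → A ∈cl F′

cl-mono : F ⊆ F′ → F ⊆cl F′
cl-mono F⊆F′ A (G , ne , G⊆F , A≐⋃G) = G , ne , (λ B B∈G → Any-resp-⊆ F⊆F′ (G⊆F B B∈G)) , A≐⋃G

cl-minimal : (∀ B → B ∈F F → B ∈cl F′) → F ⊆cl F′
cl-minimal F⊆clF′ A (G , ne , G⊆F , A≐⋃G) =
  ∈cl-resp-≐ (≐-sym A≐⋃G) (⋃-∈cl G ne (λ B B∈G → F⊆clF′ B (G⊆F B (∈⇒∈F B∈G ≐-refl))))

⊆cl-trans : F ⊆cl G → G ⊆cl F′ → F ⊆cl F′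
⊆cl-trans F⊆G G⊆F′ A A∈clF = G⊆F′ A (F⊆G A A∈clF)

covered-resp-cl : ∀ {𝓕c 𝓝c} → F ⊆cl F′ → F′ ⊆cl F → Covered F 𝓕c 𝓝c → Covered F′ 𝓕c 𝓝c
covered-resp-cl F⊆F′ _ (inj₁ (Fc , Fc∈𝓕c , F″ , F″≅Fc , F″⊆clF)) =
  inj₁ (Fc , Fc∈𝓕c , F″ , F″≅Fc , λ B B∈F″ → F⊆F′ B (F″⊆clF B B∈F″))
covered-resp-cl _ F′⊆F (inj₂ (Nc , Nc∈𝓝c , Nc′ , Nc′≅Nc , clF⊆clNc′)) =
  inj₂ (Nc , Nc∈𝓝c , Nc′ , Nc′≅Nc , λ A A∈clF′ → clF⊆clNc′ A (F′⊆F A A∈clF′))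

ReducibleIn : Family → FSet → Set
ReducibleIn F C = Σ Family λ G → NonEmpty G
  × (∀ B → B ∈F G → (B ∈F F) × ¬ (B ≐ C))
  × (C ≐ ⋃ G)

reducibleIn-resp-≐ : A ≐ B → ReducibleIn F A → ReducibleIn F B
reducibleIn-resp-≐ e (G , ne , G⊆F , A≐⋃G) =
  G , ne , (λ D D∈G → proj₁ (G⊆F D D∈G) , λ D≐B → proj₂ (G⊆F D D∈G) (≐-trans D≐B (≐-sym e)))
    , ≐-trans (≐-sym e) A≐⋃G

_⊊_ : FSet → FSet → Set
B ⊊ C = B ⊆ C × ¬ (B ≐ C)

_⊊?_ : (B C : FSet) → Dec (B ⊊ C)
B ⊊? C = B ⊆? C ×-dec ¬? (B ≐? C)

nonEmpty? : (G : Family) → Dec (NonEmpty G)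
nonEmpty? []      = no λ ()
nonEmpty? (B ∷ _) = yes (B , here ≐-refl)

-- C is reducible in F iff the members of F strictly below C cover C, which is decidable.
module _ (F : Family) (C : FSet) where

  private
    S : Family
    S = filter (_⊊? C) F

  reducibleIn⇔ : (NonEmpty S × C ⊆ ⋃ S) ⇔ ReducibleIn F C
  reducibleIn⇔ = mk⇔ toReducible fromReducible
    where
    toReducible : NonEmpty S × C ⊆ ⋃ S → ReducibleIn F C
    toReducible (ne , C⊆⋃S) = S , ne , members , ⊆-antisym C⊆⋃S ⋃S⊆C
      where
      members : ∀ B → B ∈F S → (B ∈F F) × ¬ (B ≐ C)
      members B B∈S with D , D∈S , D≐B ← find B∈S
                    with D∈F , _ , D≉C ← ∈-filter⁻ (_⊊? C) {xs = F} D∈S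
        = ∈⇒∈F D∈F D≐B , λ B≐C → D≉C (≐-trans D≐B B≐C)
      ⋃S⊆C : ⋃ S ⊆ C
      ⋃S⊆C x∈⋃S with D , x∈D , D∈S ← ∈-concat⁻′ S x∈⋃S =
        proj₁ (proj₂ (∈-filter⁻ (_⊊? C) {xs = F} D∈S)) x∈D

    fromReducible : ReducibleIn F C → NonEmpty S × C ⊆ ⋃ S
    fromReducible (G , (B , B∈G) , G⊆F , C≐⋃G) = (B , G⊆S B B∈G) , C⊆⋃S
      where
      G⊆S : ∀ B → B ∈F G → B ∈F S
      G⊆S B B∈G with D , D∈F , D≐B ← find (proj₁ (G⊆F B B∈G)) =
        ∈⇒∈F (∈-filter⁺ (_⊊? C) D∈F (D⊆C , λ D≐C → proj₂ (G⊆F B B∈G) (≐-trans (≐-sym D≐B) D≐C))) D≐B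
        where
        D⊆C : D ⊆ C
        D⊆C x∈D = ≐⇒⊇ C≐⋃G (∈F⇒⊆⋃ B∈G (≐⇒⊆ D≐B x∈D))
      C⊆⋃S : C ⊆ ⋃ S
      C⊆⋃S x∈C with D , x∈D , D∈G ← ∈-concat⁻′ G (≐⇒⊆ C≐⋃G x∈C) =
        ∈F⇒⊆⋃ (G⊆S D (∈⇒∈F D∈G ≐-refl)) x∈D

  reducibleIn? : Dec (ReducibleIn F C)
  reducibleIn? = map′ (Equivalence.to reducibleIn⇔) (Equivalence.from reducibleIn⇔)
                      (nonEmpty? S ×-dec C ⊆? ⋃ S)

irreducible⁺ : (∀ {C} → C ∈ F → ¬ ReducibleIn F C) → Irreducible F
irreducible⁺ irr A A∈F red with C , C∈F , C≐A ← find A∈F =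
  irr C∈F (reducibleIn-resp-≐ (≐-sym C≐A) red)

select : A ∈ F → ∃ λ F′ → F ↭ A ∷ F′
select A∈F with F₁ , F₂ , refl ← ∈-∃++ A∈F = F₁ ++ F₂ , shift _ F₁ F₂

deleted⊆ : F ↭ A ∷ F′ → F′ ⊆ F
deleted⊆ F↭A∷F′ B∈F′ = ∈-resp-↭ (↭-sym F↭A∷F′) (there B∈F′)

deleted-shorter : F ↭ A ∷ F′ → length F′ < length F
deleted-shorter F↭A∷F′ = subst (_ <_) (sym (↭-length F↭A∷F′)) (n<1+n _)

deleteReducible-⊆cl : F ↭ C ∷ F′ → ReducibleIn F C → F ⊆cl F′
deleteReducible-⊆cl {F} {C} {F′} F↭C∷F′ (G , ne , G⊆F , C≐⋃G) = cl-minimal members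
  where
  survives : ∀ B → B ∈F F → ¬ (B ≐ C) → B ∈F F′
  survives B B∈F B≉C with D , D∈F , D≐B ← find B∈F | ∈-resp-↭ F↭C∷F′ D∈F
  ... | here refl  = contradiction (≐-sym D≐B) B≉C
  ... | there D∈F′ = ∈⇒∈F D∈F′ D≐B
  members : ∀ B → B ∈F F → B ∈cl F′
  members B B∈F with D , D∈F , D≐B ← find B∈F | ∈-resp-↭ F↭C∷F′ D∈F
  ... | here refl  = ∈cl-resp-≐ (≐-trans (≐-sym C≐⋃G) D≐B) (G , ne , G⊆F′ , ≐-refl)
    where
    G⊆F′ : ∀ B′ → B′ ∈F G → B′ ∈F F′
    G⊆F′ B′ B′∈G = survives B′ (proj₁ (G⊆F B′ B′∈G)) (proj₂ (G⊆F B′ B′∈G))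
  ... | there D∈F′ = ∈F⇒∈cl (∈⇒∈F D∈F′ D≐B)

irreducibleCore : ∀ F → ∃ λ K → K ⊆ F × Irreducible K × F ⊆cl K
irreducibleCore F = go F (<-wellFounded (length F))
  where
  go : ∀ F → Acc _<_ (length F) → ∃ λ K → K ⊆ F × Irreducible K × F ⊆cl K
  go F (acc rec) with any? (reducibleIn? F) F
  ... | no ¬red =
    F , ⊆-refl , irreducible⁺ (λ C∈F red → ¬red (Any.map (λ { refl → red }) C∈F)) , cl-mono ⊆-refl
  ... | yes red with C , C∈F , C-red ← find red | select C∈F
  ... | F′ , F↭C∷F′ with K , K⊆F′ , K-irr , F′⊆clK ← go F′ (rec (deleted-shorter F↭C∷F′)) =
    K , ⊆-trans K⊆F′ (deleted⊆ F↭C∷F′) , K-irr , ⊆cl-trans (deleteReducible-⊆cl F↭C∷F′ C-red) F′⊆clK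

lemma4 : (n : ℕ) (𝓕c 𝓝c : Collection) →
    ((F : Family) → BoundedBy n F → Irreducible F → Covered F 𝓕c 𝓝c) →
    (F : Family) → BoundedBy n F → Covered F 𝓕c 𝓝c
lemma4 n 𝓕c 𝓝c coverIrreducible F F-bounded
  with K , K⊆F , K-irr , F⊆clK ← irreducibleCore F =
  covered-resp-cl (cl-mono K⊆F) F⊆clK (coverIrreducible K K-bounded K-irr)
  where
  K-bounded : BoundedBy n K
  K-bounded x x∈⋃K = F-bounded x (concat⁺ K⊆F x∈⋃K)
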